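{- In the $F_3$ Black Hole Zeckendorf game, if $a\equiv b\equiv 0\pmod 3$ then $(a,b)$ is a $P$ position.
   Context: The $F_3$ Black Hole Zeckendorf game: a position is a pair $(a,b)$ of nonnegative integers, the numbers of pieces in the columns of weight $F_1=1$ and $F_2=2$. Two players alternate moves; the available moves are: (merge) if $a\ge 2$, go to $(a-2,b+1)$; (add) if $a\ge1,b\ge1$, go to $(a-1,b-1)$; (split) if $b\ge 2$, go to $(a+1,b-2)$ (pieces landing in column $F_3$, the "black hole", are removed). The player making the last move wins. A position is a $P$ position if the player to move from it loses under optimal play, and an $N$ position if the player to move can force a win; positions with no move are $P$ positions. -}

module Defs where

open import Data.Nat using (ℕ; zero; suc; _+_)
open import Data.Product using (_×_; _,_; ∃)

-- A position (a , b): a pieces in column F₁ = 1, b pieces in column F₂ = 2.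
Position : Set
Position = ℕ × ℕ

data Move : Position → Position → Set where
  merge : ∀ a b → Move (suc (suc a) , b) (a , suc b)
  -- add:   a ≥ 1, b ≥ 1, (a , b) ↦ (a - 1 , b - 1)  (the F₃ piece falls into the black hole)
  add   : ∀ a b → Move (suc a , suc b) (a , b)
  split : ∀ a b → Move (a , suc (suc b)) (suc a , b)

-- Normal play (last player to move wins).
-- These inductive definitions are well founded since every move strictly
-- decreases a + 2b or the total number of pieces, so the game is finite.
data IsP : Position → Set
data IsN : Position → Set

data IsP where
  isP : ∀ {p} → (∀ q → Move p q → IsN q) → IsP p

data IsN where
  isN : ∀ {p} q → Move p q → IsP q → IsN p

{-# OPTIONS --safe #-}
module Submission where

open import Defs
open import Data.Nat using (ℕ; zero; suc; _*_)
open import Data.Nat.Divisibility using (_∣_; divides)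
open import Data.Product using (_,_)
open import Relation.Binary.PropositionalEquality using (refl)

-- The second player keeps both columns divisible by 3: merge is answered by
-- add, add by merge and split by add. Each such round lowers a or b by exactly
-- 3, so the answers stay available until the first player is out of moves.

-- Multiples of 3 are written i * 3 rather than 3 * i because suc i * 3
-- reduces to suc (suc (suc (i * 3))), which lets the moves be matched directly.
isP-multiples-of-3 : ∀ i j → IsP (i * 3 , j * 3)
isN-after-move-from-multiples-of-3 : ∀ i j q → Move (i * 3 , j * 3) q → IsN q

isP-multiples-of-3 i j = isP (isN-after-move-from-multiples-of-3 i j)

isN-after-move-from-multiples-of-3 (suc i) zero    _ (merge _ _) = isN _ (add _ _)   (isP-multiples-of-3 i zero)
isN-after-move-from-multiples-of-3 (suc i) (suc j) _ (merge _ _) = isN _ (add _ _)   (isP-multiples-of-3 i (suc j))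
isN-after-move-from-multiples-of-3 (suc i) (suc j) _ (add _ _)   = isN _ (merge _ _) (isP-multiples-of-3 i (suc j))
isN-after-move-from-multiples-of-3 zero    (suc j) _ (split _ _) = isN _ (add _ _)   (isP-multiples-of-3 zero j)
isN-after-move-from-multiples-of-3 (suc i) (suc j) _ (split _ _) = isN _ (add _ _)   (isP-multiples-of-3 (suc i) j)
isN-after-move-from-multiples-of-3 zero    zero    _ ()

theorem4p4 : ∀ (a b : ℕ) → 3 ∣ a → 3 ∣ b → IsP (a , b)
theorem4p4 _ _ (divides i refl) (divides j refl) = isP-multiples-of-3 i j
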